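{- Let $G$ be a König–Egerváry graph. Then: (i) for every $\alpha$-critical edge $e$ of $G$, the graph $G-e$ is also a König–Egerváry graph; (ii) every $\alpha$-critical edge of $G$ is also $\mu$-critical; (iii) the set of all $\alpha$-critical edges of $G$ is a matching (no two $\alpha$-critical edges share an endpoint).
   Context: All graphs are finite and simple; following the paper's standing convention, "graph" means a connected graph with at least one edge (the definitions below make sense for arbitrary finite simple graphs). $\alpha(G)$ is the stability number (maximum size of a stable set), $\mu(G)$ the size of a maximum matching, $n(G)=|V(G)|$. $G$ is a König–Egerváry graph if $\alpha(G)+\mu(G)=n(G)$. For an edge $e$, $G-e$ denotes the graph obtained by deleting $e$ (keeping all vertices). An edge $e$ is $\alpha$-critical if $\alpha(G-e)>\alpha(G)$, and $\mu$-critical if $\mu(G-e)<\mu(G)$. -}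

module Defs where

open import Data.Nat using (ℕ; _+_; _≤_; _<_)
open import Data.Bool using (Bool; true; false; _∧_; not)
open import Data.Fin using (Fin)
open import Data.Fin.Properties using () renaming (_≟_ to _≟ᶠ_)
open import Data.Fin.Subset using (Subset; _∈_; ∣_∣)
open import Data.List using (List; []; _∷_; length; concatMap)
open import Data.List.Relation.Unary.All using (All)
open import Data.List.Relation.Unary.Unique.Propositional using (Unique)
open import Data.Product using (_×_; _,_; Σ; ∃; ∃-syntax)
open import Data.Sum using (_⊎_)
open import Relation.Binary.PropositionalEquality using (_≡_)
open import Relation.Nullary.Decidable using (⌊_⌋)

record Graph (n : ℕ) : Set where
  field
    adj     : Fin n → Fin n → Bool
    adj-sym : ∀ x y → adj x y ≡ adj y x
    irrefl  : ∀ x → adj x x ≡ false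
open Graph public

data Reach {n : ℕ} (G : Graph n) : Fin n → Fin n → Set where
  here : ∀ {x} → Reach G x x
  step : ∀ {x y z} → adj G x y ≡ true → Reach G y z → Reach G x z

Connected : {n : ℕ} → Graph n → Set
Connected G = ∀ x y → Reach G x y

HasEdge : {n : ℕ} → Graph n → Set
HasEdge G = ∃[ x ] ∃[ y ] (adj G x y ≡ true)

-- The paper's standing convention: a graph is connected with at least one edge.
StandingGraph : {n : ℕ} → Graph n → Set
StandingGraph G = Connected G × HasEdge G

samePair : {n : ℕ} → Fin n → Fin n → Fin n → Fin n → Bool
samePair u v x y =
  (⌊ x ≟ᶠ u ⌋ ∧ ⌊ y ≟ᶠ v ⌋) Data.Bool.∨ (⌊ x ≟ᶠ v ⌋ ∧ ⌊ y ≟ᶠ u ⌋)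

deleteEdge : {n : ℕ} → (G : Graph n) → Fin n → Fin n → Graph n
deleteEdge {n} G u v = record
  { adj     = λ x y → adj G x y ∧ not (samePair u v x y)
  ; adj-sym = sym'
  ; irrefl  = irr
  }
  where
  open import Relation.Binary.PropositionalEquality using (refl; cong; cong₂)
  open import Relation.Nullary using (yes; no)
  open import Data.Bool.Properties using (∨-comm)
  swap : ∀ x y → samePair u v x y ≡ samePair u v y x
  swap x y with x ≟ᶠ u | y ≟ᶠ v | x ≟ᶠ v | y ≟ᶠ u
  ... | a | b | c | d = ∨-comm (⌊ a ⌋ ∧ ⌊ b ⌋) (⌊ c ⌋ ∧ ⌊ d ⌋) ▹ fix a b c d
    where
    _▹_ : ∀ {A : Set} {p q r : A} → p ≡ q → q ≡ r → p ≡ r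
    refl ▹ e = e
    open import Data.Bool.Properties using (∧-comm)
    fix : ∀ a b c d → (⌊ c ⌋ ∧ ⌊ d ⌋) Data.Bool.∨ (⌊ a ⌋ ∧ ⌊ b ⌋)
                    ≡ ((⌊ d ⌋ ∧ ⌊ c ⌋) Data.Bool.∨ (⌊ b ⌋ ∧ ⌊ a ⌋))
    fix a b c d = cong₂ Data.Bool._∨_ (∧-comm ⌊ c ⌋ ⌊ d ⌋) (∧-comm ⌊ a ⌋ ⌊ b ⌋)
  sym' : ∀ x y → (adj G x y ∧ not (samePair u v x y)) ≡ (adj G y x ∧ not (samePair u v y x))
  sym' x y = cong₂ _∧_ (adj-sym G x y) (cong not (swap x y))
  irr : ∀ x → (adj G x x ∧ not (samePair u v x x)) ≡ false
  irr x with adj G x x | irrefl G x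
  ... | .false | refl = refl

Stable : {n : ℕ} → Graph n → Subset n → Set
Stable G S = ∀ x y → x ∈ S → y ∈ S → adj G x y ≡ false

IsAlpha : {n : ℕ} → Graph n → ℕ → Set
IsAlpha G k = (Σ _ λ S → Stable G S × ∣ S ∣ ≡ k) × (∀ S → Stable G S → ∣ S ∣ ≤ k)

endpoints : {n : ℕ} → List (Fin n × Fin n) → List (Fin n)
endpoints = concatMap (λ { (a , b) → a ∷ b ∷ [] })

IsMatching : {n : ℕ} → Graph n → List (Fin n × Fin n) → Set
IsMatching G M = All (λ { (a , b) → adj G a b ≡ true }) M × Unique (endpoints M)

IsMu : {n : ℕ} → Graph n → ℕ → Set
IsMu G k = (Σ _ λ M → IsMatching G M × length M ≡ k)
         × (∀ M → IsMatching G M → length M ≤ k)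

KonigEgervary : {n : ℕ} → Graph n → Set
KonigEgervary {n} G = ∃[ a ] ∃[ m ] (IsAlpha G a × IsMu G m × a + m ≡ n)

AlphaCritical : {n : ℕ} → Graph n → Fin n → Fin n → Set
AlphaCritical G u v = adj G u v ≡ true
  × ∃[ a ] ∃[ a' ] (IsAlpha G a × IsAlpha (deleteEdge G u v) a' × a < a')

MuCritical : {n : ℕ} → Graph n → Fin n → Fin n → Set
MuCritical G u v = adj G u v ≡ true
  × ∃[ m ] ∃[ m' ] (IsMu G m × IsMu (deleteEdge G u v) m' × m' < m)

{-# OPTIONS --safe #-}
-- Weak duality: for a stable set S and a matching M of any graph, |S| + |M| ≤ n, since the
-- complement of S meets every edge of M and these edges are pairwise disjoint.  Let G be
-- König–Egerváry, with S and M attaining |S| + |M| = n, and let e be α-critical.  Then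
-- M - e is a matching of G - e with at least |M| - 1 edges while α(G - e) ≥ |S| + 1, so
-- weak duality in G - e is again tight: G - e is König–Egerváry, μ(G - e) = |M| - 1, and
-- e ∈ M.  Thus all α-critical edges lie in the one matching M, so no two of them meet.
module Submission where

open import Defs
open import Data.Nat using (ℕ; suc; _+_; _∸_; _≤_; _<_; z≤n; s≤s)
open import Data.Nat.Properties
open import Data.Bool using (true; false; not; _∧_)
open import Data.Bool.Properties using (¬-not) renaming (_≟_ to _≟ᵇ_)
open import Data.Fin using (Fin)
open import Data.Fin.Properties using () renaming (_≟_ to _≟ᶠ_)
open import Data.Fin.Subset using (Subset; _∈_; ∣_∣; ∁; _-_)
open import Data.Fin.Subset.Properties
  using (_∈?_; ∣p∣≤n; ∣∁p∣≡n∸∣p∣; x∉p⇒x∈∁p; x∈p∧x≢y⇒x∈p-y; x∈p⇒∣p-x∣<∣p∣)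
open import Data.List using (List; []; _∷_; length; filter)
open import Data.List.Properties using (filter-all)
open import Data.List.Relation.Unary.All as All using (All; []; _∷_)
open import Data.List.Relation.Unary.All.Properties using (all-filter; filter⁺; ¬All⇒Any¬)
open import Data.List.Relation.Unary.Any as Any using (Any; here; there)
open import Data.List.Relation.Unary.AllPairs using (AllPairs; []; _∷_)
open import Data.List.Relation.Unary.Unique.Propositional using (Unique)
open import Data.List.Membership.Propositional using (find) renaming (_∈_ to _∈ₗ_)
open import Data.List.Relation.Binary.Sublist.Propositional using (_⊆_; []; _∷_; _∷ʳ_)
open import Data.List.Relation.Binary.Sublist.Propositional.Properties using (All-resp-⊆; filter-⊆)
open import Data.Product using (_×_; _,_; ∃-syntax; proj₂; uncurry)
open import Data.Sum as Sum using (_⊎_; inj₁; inj₂)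
open import Relation.Binary.PropositionalEquality
open import Relation.Nullary using (Dec; yes; no; contradiction)

variable
  n : ℕ
  p q u v w x y : Fin n
  e f : Fin n × Fin n
  M N : List (Fin n × Fin n)
  S T : Subset n

infix 4 _≐_

_≐_ : Fin n × Fin n → Fin n × Fin n → Set
(u , v) ≐ (x , y) = (u ≡ x × v ≡ y) ⊎ (u ≡ y × v ≡ x)

≐-sym : e ≐ f → f ≐ e
≐-sym (inj₁ (refl , refl)) = inj₁ (refl , refl)
≐-sym (inj₂ (refl , refl)) = inj₂ (refl , refl)

≐-trans : {g : Fin n × Fin n} → e ≐ f → f ≐ g → e ≐ g
≐-trans (inj₁ (refl , refl)) f≐g = f≐g
≐-trans (inj₂ (refl , refl)) (inj₁ (refl , refl)) = inj₂ (refl , refl)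
≐-trans (inj₂ (refl , refl)) (inj₂ (refl , refl)) = inj₁ (refl , refl)

samePair⇒≐ : samePair u v x y ≡ true → (u , v) ≐ (x , y)
samePair⇒≐ {u = u} {v} {x} {y} eq with x ≟ᶠ u | y ≟ᶠ v | x ≟ᶠ v | y ≟ᶠ u
... | yes refl | yes refl | _       | _       = inj₁ (refl , refl)
... | yes _    | no _     | yes refl | yes refl = inj₂ (refl , refl)
... | no _     | _        | yes refl | yes refl = inj₂ (refl , refl)
... | yes _    | no _     | yes _    | no _    = contradiction eq λ ()
... | yes _    | no _     | no _     | _       = contradiction eq λ ()
... | no _     | _        | yes _    | no _    = contradiction eq λ ()
... | no _     | _        | no _     | _       = contradiction eq λ ()

Incident : Fin n → Fin n × Fin n → Set
Incident w (p , q) = w ≡ p ⊎ w ≡ q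

Incident-resp-≐ : e ≐ f → Incident w e → Incident w f
Incident-resp-≐ (inj₁ (refl , refl)) = λ w∈e → w∈e
Incident-resp-≐ (inj₂ (refl , refl)) = Sum.swap

sharedVertex : u ≡ x ⊎ u ≡ y ⊎ v ≡ x ⊎ v ≡ y →
               ∃[ w ] Incident w (u , v) × Incident w (x , y)
sharedVertex {u = u} (inj₁ u≡x)                = u , inj₁ refl , inj₁ u≡x
sharedVertex {u = u} (inj₂ (inj₁ u≡y))         = u , inj₁ refl , inj₂ u≡y
sharedVertex {v = v} (inj₂ (inj₂ (inj₁ v≡x))) = v , inj₂ refl , inj₁ v≡x
sharedVertex {v = v} (inj₂ (inj₂ (inj₂ v≡y))) = v , inj₂ refl , inj₂ v≡y

∈-endpoints : e ∈ₗ M → Incident w e → w ∈ₗ endpoints M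
∈-endpoints (here refl) (inj₁ refl) = here refl
∈-endpoints (here refl) (inj₂ refl) = there (here refl)
∈-endpoints (there e∈M) w∈e        = there (there (∈-endpoints e∈M w∈e))

head-fresh : Unique (endpoints (e ∷ M)) → Incident w e → All (w ≢_) (endpoints M)
head-fresh ((_ ∷ p-fresh) ∷ _ ∷ _) (inj₁ refl) = p-fresh
head-fresh (_ ∷ q-fresh ∷ _)       (inj₂ refl) = q-fresh

incident-edges-equal : Unique (endpoints M) → e ∈ₗ M → f ∈ₗ M →
                       Incident w e → Incident w f → e ≡ f
incident-edges-equal _ (here refl) (here refl) _ _ = refl
incident-edges-equal {M = _ ∷ M} unique (here refl) (there f∈M) w∈e w∈f =
  contradiction refl (All.lookup (head-fresh {M = M} unique w∈e) (∈-endpoints f∈M w∈f))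
incident-edges-equal {M = _ ∷ M} unique (there e∈M) (here refl) w∈e w∈f =
  contradiction refl (All.lookup (head-fresh {M = M} unique w∈f) (∈-endpoints e∈M w∈e))
incident-edges-equal (_ ∷ _ ∷ unique′) (there e∈M) (there f∈M) w∈e w∈f =
  incident-edges-equal unique′ e∈M f∈M w∈e w∈f

meeting-matched-edges-≐ : Unique (endpoints M) → Any (e ≐_) M → Any (f ≐_) M →
                          Incident w e → Incident w f → e ≐ f
meeting-matched-edges-≐ unique e∈M f∈M w∈e w∈f
  with find e∈M | find f∈M
... | e′ , e′∈M , e≐e′ | f′ , f′∈M , f≐f′
  with incident-edges-equal unique e′∈M f′∈M (Incident-resp-≐ e≐e′ w∈e) (Incident-resp-≐ f≐f′ w∈f)
... | refl = ≐-trans e≐e′ (≐-sym f≐f′)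

Meets : Subset n → Fin n × Fin n → Set
Meets T (p , q) = p ∈ T ⊎ q ∈ T

All-Meets-remove : All (x ≢_) (endpoints M) → All (Meets T) M → All (Meets (T - x)) M
All-Meets-remove {M = []}    _ [] = []
All-Meets-remove {M = _ ∷ _} (x≢p ∷ x≢q ∷ x-fresh) (meets ∷ meets′) =
  Sum.map (λ p∈T → x∈p∧x≢y⇒x∈p-y p∈T (≢-sym x≢p))
          (λ q∈T → x∈p∧x≢y⇒x∈p-y q∈T (≢-sym x≢q)) meets
  ∷ All-Meets-remove x-fresh meets′

length≤∣cover∣ : Unique (endpoints M) → All (Meets T) M → length M ≤ ∣ T ∣
length≤∣cover∣ {M = []} _ _ = z≤n
length≤∣cover∣ {M = e ∷ M} {T} unique@(_ ∷ _ ∷ unique′) (meets ∷ meets′) =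
  Sum.[ remove (inj₁ refl) , remove (inj₂ refl) ] meets
  where
  remove : Incident x e → x ∈ T → suc (length M) ≤ ∣ T ∣
  remove x∈e x∈T = ≤-<-trans
    (length≤∣cover∣ unique′ (All-Meets-remove (head-fresh {M = M} unique x∈e) meets′))
    (x∈p⇒∣p-x∣<∣p∣ x∈T)

∁-stable-meets-edge : {H : Graph n} → Stable H S → adj H p q ≡ true → Meets (∁ S) (p , q)
∁-stable-meets-edge {S = S} {p} {q} S-stable pq with p ∈? S | q ∈? S
... | no p∉S  | _        = inj₁ (x∉p⇒x∈∁p p∉S)
... | yes _   | no q∉S   = inj₂ (x∉p⇒x∈∁p q∉S)
... | yes p∈S | yes q∈S  = contradiction (trans (sym (S-stable p q p∈S q∈S)) pq) λ ()

∣stable∣+∣matching∣≤n : {H : Graph n} → Stable H S → IsMatching H M → ∣ S ∣ + length M ≤ n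
∣stable∣+∣matching∣≤n {n} {S} {M} {H} S-stable (M-edges , M-unique) = begin
  ∣ S ∣ + length M      ≤⟨ +-monoʳ-≤ ∣ S ∣ (length≤∣cover∣ M-unique covered) ⟩
  ∣ S ∣ + ∣ ∁ S ∣       ≡⟨ cong (∣ S ∣ +_) (∣∁p∣≡n∸∣p∣ S) ⟩
  ∣ S ∣ + (n ∸ ∣ S ∣)   ≡⟨ m+[n∸m]≡n (∣p∣≤n S) ⟩
  n                     ∎
  where
  open ≤-Reasoning
  covered : All (Meets (∁ S)) M
  covered = All.map (∁-stable-meets-edge {H = H} S-stable) M-edges

tight⇒IsAlpha×IsMu : {H : Graph n} → Stable H S → IsMatching H M → ∣ S ∣ + length M ≡ n →
                     IsAlpha H ∣ S ∣ × IsMu H (length M)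
tight⇒IsAlpha×IsMu {S = S} {M} {H} S-stable M-matching tight =
  ((S , S-stable , refl) , λ T T-stable → +-cancelʳ-≤ (length M) _ _
      (≤-trans (∣stable∣+∣matching∣≤n {H = H} T-stable M-matching) (≤-reflexive (sym tight)))) ,
  ((M , M-matching , refl) , λ N N-matching → +-cancelˡ-≤ ∣ S ∣ _ _
      (≤-trans (∣stable∣+∣matching∣≤n {H = H} S-stable N-matching) (≤-reflexive (sym tight))))

tight⇒KonigEgervary : {H : Graph n} → Stable H S → IsMatching H M → ∣ S ∣ + length M ≡ n →
                      KonigEgervary H
tight⇒KonigEgervary {S = S} {M} {H} S-stable M-matching tight =
  let α , μ = tight⇒IsAlpha×IsMu {H = H} S-stable M-matching tight
  in ∣ S ∣ , length M , α , μ , tight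

AllPairs-resp-⊇ : ∀ {A : Set} {R : A → A → Set} {xs ys : List A} →
                  xs ⊆ ys → AllPairs R ys → AllPairs R xs
AllPairs-resp-⊇ []             []           = []
AllPairs-resp-⊇ (_ ∷ʳ xs⊆ys)   (_ ∷ R-ys)   = AllPairs-resp-⊇ xs⊆ys R-ys
AllPairs-resp-⊇ (refl ∷ xs⊆ys) (R-y ∷ R-ys) = All-resp-⊆ xs⊆ys R-y ∷ AllPairs-resp-⊇ xs⊆ys R-ys

endpoints-⊆ : M ⊆ N → endpoints M ⊆ endpoints N
endpoints-⊆ []           = []
endpoints-⊆ (_ ∷ʳ M⊆N)   = _ ∷ʳ _ ∷ʳ endpoints-⊆ M⊆N
endpoints-⊆ (refl ∷ M⊆N) = refl ∷ refl ∷ endpoints-⊆ M⊆N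

adj-deleteEdge : {G : Graph n} → adj G p q ≡ true → samePair u v p q ≡ false →
                 adj (deleteEdge G u v) p q ≡ true
adj-deleteEdge pq differs = cong₂ (λ a s → a ∧ not s) pq differs

differs? : (u v : Fin n) (e : Fin n × Fin n) → Dec (uncurry (samePair u v) e ≡ false)
differs? u v e = uncurry (samePair u v) e ≟ᵇ false

dropEdge : Fin n → Fin n → List (Fin n × Fin n) → List (Fin n × Fin n)
dropEdge u v = filter (differs? u v)

dropEdge-isMatching : {G : Graph n} → IsMatching G M → IsMatching (deleteEdge G u v) (dropEdge u v M)
dropEdge-isMatching {M = M} {u = u} {v} {G} (M-edges , M-unique) =
  All.zipWith (λ (differs , pq) → adj-deleteEdge {G = G} pq differs)
              (all-filter (differs? u v) M , filter⁺ (differs? u v) M-edges) ,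
  AllPairs-resp-⊇ (endpoints-⊆ (filter-⊆ (differs? u v) M)) M-unique

dropEdge-fresh : All (u ≢_) (endpoints M) → dropEdge u v M ≡ M
dropEdge-fresh {u = u} {M = M} {v = v} u-fresh =
  filter-all (differs? u v) (All.tabulate λ e∈M → ¬-not λ same →
    All.lookup u-fresh (∈-endpoints {M = M} e∈M (Incident-resp-≐ (samePair⇒≐ same) (inj₁ refl))) refl)

length-dropEdge : Unique (endpoints M) → length M ≤ suc (length (dropEdge u v M))
length-dropEdge {M = []} _ = z≤n
length-dropEdge {M = e ∷ M} {u = u} {v} unique@(_ ∷ _ ∷ unique′) with differs? u v e
... | yes _    = s≤s (length-dropEdge {M = M} {u = u} {v} unique′)
... | no same  = s≤s (≤-reflexive (cong length (sym (dropEdge-fresh {M = M} {v = v} u-fresh))))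
  where
  u-fresh : All (u ≢_) (endpoints M)
  u-fresh = head-fresh {M = M} unique (Incident-resp-≐ (samePair⇒≐ (¬-not same)) (inj₁ refl))

dropEdge-shorter⇒∈ : length (dropEdge u v M) < length M → Any ((u , v) ≐_) M
dropEdge-shorter⇒∈ {u = u} {v} {M} shorter =
  Any.map (λ ¬differs → samePair⇒≐ (¬-not ¬differs)) (¬All⇒Any¬ (differs? u v) M λ all →
    <-irrefl (cong length (filter-all (differs? u v) all)) shorter)

tightness-transfer : ∀ {s k s′ k′} → s + k ≡ n → s < s′ → k ≤ suc k′ → s′ + k′ ≤ n →
                     s′ + k′ ≡ n × k′ < k
tightness-transfer {n} {s} {k} {s′} {k′} tight s<s′ k≤1+k′ s′+k′≤n =
  ≤-antisym s′+k′≤n n≤s′+k′ , +-cancelˡ-≤ s (suc k′) k s+1+k′≤s+k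
  where
  open ≤-Reasoning
  shifted : s + suc k′ ≤ s′ + k′
  shifted = begin
    s + suc k′  ≡⟨ +-suc s k′ ⟩
    suc s + k′  ≤⟨ +-monoˡ-≤ k′ s<s′ ⟩
    s′ + k′     ∎
  n≤s′+k′ : n ≤ s′ + k′
  n≤s′+k′ = begin
    n           ≡⟨ sym tight ⟩
    s + k       ≤⟨ +-monoʳ-≤ s k≤1+k′ ⟩
    s + suc k′  ≤⟨ shifted ⟩
    s′ + k′     ∎
  s+1+k′≤s+k : s + suc k′ ≤ s + k
  s+1+k′≤s+k = begin
    s + suc k′  ≤⟨ shifted ⟩
    s′ + k′     ≤⟨ s′+k′≤n ⟩
    n           ≡⟨ sym tight ⟩
    s + k       ∎

module AlphaCriticalEdge {G : Graph n} (S-stable : Stable G S) (M-matching : IsMatching G M)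
         (tight : ∣ S ∣ + length M ≡ n) where

  alphaCritical⇒tight-deletion :
    AlphaCritical G u v →
    ∃[ S′ ] Stable (deleteEdge G u v) S′
          × ∣ S′ ∣ + length (dropEdge u v M) ≡ n × length (dropEdge u v M) < length M
  alphaCritical⇒tight-deletion {u = u} {v} (_ , _ , _ , α-G , ((S′ , S′-stable , refl) , _) , α<α′) =
    S′ , S′-stable ,
    tightness-transfer tight (≤-<-trans (proj₂ α-G S S-stable) α<α′)
      (length-dropEdge {M = M} {u = u} {v} (proj₂ M-matching))
      (∣stable∣+∣matching∣≤n {H = deleteEdge G u v} S′-stable
         (dropEdge-isMatching {G = G} M-matching))

  alphaCritical⇒KonigEgervary-deleteEdge : AlphaCritical G u v → KonigEgervary (deleteEdge G u v)
  alphaCritical⇒KonigEgervary-deleteEdge {u = u} {v} critical =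
    let S′ , S′-stable , tight′ , _ = alphaCritical⇒tight-deletion critical
    in tight⇒KonigEgervary {H = deleteEdge G u v} S′-stable
         (dropEdge-isMatching {G = G} M-matching) tight′

  alphaCritical⇒MuCritical : AlphaCritical G u v → MuCritical G u v
  alphaCritical⇒MuCritical {u = u} {v} critical@(uv , _) =
    let S′ , S′-stable , tight′ , shorter = alphaCritical⇒tight-deletion critical
    in uv , length M , length (dropEdge u v M) ,
       proj₂ (tight⇒IsAlpha×IsMu {H = G} S-stable M-matching tight) ,
       proj₂ (tight⇒IsAlpha×IsMu {H = deleteEdge G u v} S′-stable
                (dropEdge-isMatching {G = G} M-matching) tight′) ,
       shorter

  alphaCritical⇒matched : AlphaCritical G u v → Any ((u , v) ≐_) M
  alphaCritical⇒matched critical =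
    dropEdge-shorter⇒∈ (proj₂ (proj₂ (proj₂ (alphaCritical⇒tight-deletion critical))))

theorem2p3 : {n : ℕ} (G : Graph n) → StandingGraph G → KonigEgervary G →
    (∀ u v → AlphaCritical G u v → KonigEgervary (deleteEdge G u v))
    × (∀ u v → AlphaCritical G u v → MuCritical G u v)
    × (∀ u v x y → AlphaCritical G u v → AlphaCritical G x y →
         (u ≡ x ⊎ u ≡ y ⊎ v ≡ x ⊎ v ≡ y) →
         (u ≡ x × v ≡ y) ⊎ (u ≡ y × v ≡ x))
theorem2p3 G _ (_ , _ , ((S , S-stable , refl) , _) , ((M , M-matching , refl) , _) , tight) =
  (λ _ _ → alphaCritical⇒KonigEgervary-deleteEdge) ,
  (λ _ _ → alphaCritical⇒MuCritical) ,
  λ _ _ _ _ uv-critical xy-critical meet →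
    let w , w∈uv , w∈xy = sharedVertex meet
    in meeting-matched-edges-≐ (proj₂ M-matching)
         (alphaCritical⇒matched uv-critical) (alphaCritical⇒matched xy-critical) w∈uv w∈xy
  where open AlphaCriticalEdge {G = G} S-stable M-matching tight
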